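{- Let $n,k,s$ be positive integers with $n\ge k^2$, and let $F_1,\dots,F_s\subset[n]$ be pairwise disjoint sets each of size at most $k$. Then the number of sets $A\in\binom{[n]}{k}$ with $A\cap F_j\ne\emptyset$ for all $j=1,\dots,s$ is at most $\big(\frac{k^2}{n}\big)^s\binom{n}{k}$.
   Context: $\binom{[n]}{k}$ is the family of $k$-subsets of $[n]$. -}

module Defs where

open import Data.Nat using (ℕ; zero; suc)
open import Data.Bool using (true; false)
open import Data.Fin using (Fin)
open import Data.Fin.Subset using (Subset; _∩_; ∣_∣; Nonempty; inside; outside)
open import Data.Fin.Subset.Properties using (nonempty?)
open import Data.Fin.Properties using (all?)
open import Data.Vec using (_∷_; [])
open import Data.List using (List; []; _∷_; map; _++_; filter; length)
open import Data.Nat.Properties using (_≟_)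
open import Relation.Binary.PropositionalEquality using (_≡_)
open import Relation.Nullary using (Dec)
open import Relation.Nullary.Decidable using (_×-dec_)
open import Data.Product using (_×_)

allSubsets : (n : ℕ) → List (Subset n)
allSubsets zero = [] ∷ []
allSubsets (suc n) = map (inside ∷_) (allSubsets n) ++ map (outside ∷_) (allSubsets n)

Transversal : ∀ {n s} (k : ℕ) (F : Fin s → Subset n) (A : Subset n) → Set
Transversal k F A = (∣ A ∣ ≡ k) × (∀ j → Nonempty (A ∩ F j))

transversal? : ∀ {n s} (k : ℕ) (F : Fin s → Subset n) (A : Subset n) → Dec (Transversal k F A)
transversal? k F A = (∣ A ∣ ≟ k) ×-dec all? (λ j → nonempty? (A ∩ F j))

countTransversals : ∀ {s} (n k : ℕ) (F : Fin s → Subset n) → ℕ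
countTransversals n k F = length (filter (transversal? k F) (allSubsets n))

PairwiseDisjoint : ∀ {n s} (F : Fin s → Subset n) → Set
PairwiseDisjoint {s = s} F = ∀ (i j : Fin s) → i ≢ j → ∀ x → x Data.Fin.Subset.∈ F i → x Data.Fin.Subset.∉ F j
  where open import Relation.Binary.PropositionalEquality using (_≢_)

-- Every transversal arises by choosing a point of each F_j and then k ∸ s further points, so,
-- the F_j being disjoint, there are at most ∏ |F_j| · C(n ∸ s, k ∸ s) of them; this is proved by
-- induction on n, splitting the k-subsets of [n] on whether they contain the point 0.  Then
-- C(n ∸ s, k ∸ s) / C(n, k) = ∏_{i<s} (k ∸ i) / (n ∸ i) ≤ (k / n)^s and ∏ |F_j| ≤ k^s.

module Submission where

open import Defs
open import Data.Nat using (ℕ; zero; suc; _+_; _*_; _^_; _≤_; z≤n; s≤s; NonZero)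
open import Data.Nat.Properties
open import Algebra.Properties.CommutativeSemigroup *-commutativeSemigroup using (x∙yz≈y∙xz; x∙yz≈xz∙y; x∙yz≈yx∙z)
open import Data.Nat.Combinatorics using (_C_; nC1≡n; k>n⇒nCk≡0; nCk+nC[k+1]≡[n+1]C[k+1])
open import Data.Nat.ListAction using (product)
open import Data.Nat.Tactic.RingSolver using (solve-∀)
open import Data.Vec using (_∷_; []; tail)
open import Data.Vec.Base using (here; there)
open import Data.List using (List; []; _∷_; map; filter; length; _++_; tabulate)
open import Data.List.Properties using (filter-++; length-++; length-map; filter-all; filter-none; filter-≐; length-tabulate)
open import Data.List.Relation.Unary.All as All using (All; []; _∷_; all?)
import Data.List.Relation.Unary.All.Properties as Allₚ
open import Data.List.Relation.Unary.AllPairs as AllPairs using (AllPairs; []; _∷_)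
import Data.List.Relation.Unary.AllPairs.Properties as AllPairsₚ
open import Data.Fin using (Fin; zero; suc)
open import Data.Fin.Subset using (Subset; _∩_; ∣_∣; Nonempty; inside; outside; _∈_; _∉_)
open import Data.Fin.Subset.Properties using (nonempty?; _∈?_)
open import Data.Product using (_×_; _,_; map₂)
open import Function using (_∘_)
open import Relation.Binary.PropositionalEquality
open import Relation.Nullary using (Dec; yes; no; contradiction)
open import Relation.Nullary.Decidable using (_×-dec_; ¬?)
open import Relation.Unary using (Pred; Decidable)

private variable n : ℕ

[1+k]*[1+n]C[1+k]≡[1+n]*nCk : ∀ n k → suc k * (suc n C suc k) ≡ suc n * (n C k)
[1+k]*[1+n]C[1+k]≡[1+n]*nCk zero    zero    = refl
[1+k]*[1+n]C[1+k]≡[1+n]*nCk zero    (suc k) =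
  trans (cong (suc (suc k) *_) (k>n⇒nCk≡0 {1} {suc (suc k)} (s≤s (s≤s z≤n)))) (*-zeroʳ (suc (suc k)))
[1+k]*[1+n]C[1+k]≡[1+n]*nCk (suc n) zero    =
  trans (+-identityʳ _) (trans (nC1≡n (suc (suc n))) (sym (*-identityʳ (suc (suc n)))))
[1+k]*[1+n]C[1+k]≡[1+n]*nCk (suc n) (suc k) = begin
  suc (suc k) * (suc (suc n) C suc (suc k))
    ≡⟨ cong (suc (suc k) *_) (nCk+nC[k+1]≡[n+1]C[k+1] (suc n) (suc k)) ⟨
  suc (suc k) * (x + suc n C suc (suc k))
    ≡⟨ regroup₁ k x (suc n C suc (suc k)) ⟩
  suc k * x + x + suc (suc k) * (suc n C suc (suc k))
    ≡⟨ cong₂ (λ a b → a + x + b) ([1+k]*[1+n]C[1+k]≡[1+n]*nCk n k) ([1+k]*[1+n]C[1+k]≡[1+n]*nCk n (suc k)) ⟩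
  suc n * (n C k) + x + suc n * (n C suc k)
    ≡⟨ regroup₂ n (n C k) x (n C suc k) ⟩
  suc n * (n C k + n C suc k) + x
    ≡⟨ cong (λ a → suc n * a + x) (nCk+nC[k+1]≡[n+1]C[k+1] n k) ⟩
  suc n * x + x
    ≡⟨ +-comm (suc n * x) x ⟩
  suc (suc n) * x ∎
  where
  open ≡-Reasoning
  x = suc n C suc k
  regroup₁ : ∀ k x y → suc (suc k) * (x + y) ≡ suc k * x + x + suc (suc k) * y
  regroup₁ = solve-∀
  regroup₂ : ∀ n a x b → suc n * a + x + suc n * b ≡ suc n * (a + b) + x
  regroup₂ = solve-∀

nCk≤[1+n]Ck : ∀ n k → n C k ≤ suc n C k
nCk≤[1+n]Ck n zero    = ≤-refl
nCk≤[1+n]Ck n (suc k) =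
  ≤-trans (m≤n+m (n C suc k) (n C k)) (≤-reflexive (nCk+nC[k+1]≡[n+1]C[k+1] n k))

^-distribʳ-* : ∀ m n o → (m * n) ^ o ≡ m ^ o * n ^ o
^-distribʳ-* m n zero    = refl
^-distribʳ-* m n (suc o) =
  trans (cong (m * n *_) (^-distribʳ-* m n o)) ([m*n]*[o*p]≡[m*o]*[n*p] m n (m ^ o) (n ^ o))

-- C(n ∸ s, k ∸ s), made to vanish when s exceeds n or k: the number of ways to
-- extend a fixed s-subset of [n] to a k-subset.
completions : ℕ → ℕ → ℕ → ℕ
completions n       k       zero    = n C k
completions zero    k       (suc s) = 0
completions (suc n) zero    (suc s) = 0
completions (suc n) (suc k) (suc s) = completions n k s

completions-mono : ∀ n k s → completions n k s ≤ completions (suc n) k s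
completions-mono n       k       zero    = nCk≤[1+n]Ck n k
completions-mono zero    k       (suc s) = z≤n
completions-mono (suc n) zero    (suc s) = z≤n
completions-mono (suc n) (suc k) (suc s) = completions-mono n k s

completions-pascal : ∀ n k s → completions n k s + completions n (suc k) s ≤ completions (suc n) (suc k) s
completions-pascal n       k       zero    = ≤-reflexive (nCk+nC[k+1]≡[n+1]C[k+1] n k)
completions-pascal zero    k       (suc s) = z≤n
completions-pascal (suc n) zero    (suc s) = completions-mono n zero s
completions-pascal (suc n) (suc k) (suc s) = completions-pascal n k s

-- x / y ≤ (j / n)^s implies x / y ≤ ((1 + j) / (1 + n))^s, since j / n ≤ (1 + j) / (1 + n).
ratio-bound-suc : ∀ {j n} x y s .{{_ : NonZero j}} → j ≤ n →
                  x * n ^ s ≤ j ^ s * y → x * suc n ^ s ≤ suc j ^ s * y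
ratio-bound-suc {j} {n} x y s j≤n x*nˢ≤jˢ*y = *-cancelˡ-≤ (j ^ s) {{m^n≢0 j s}} (begin
  j ^ s * (x * suc n ^ s)  ≡⟨ x∙yz≈y∙xz (j ^ s) x (suc n ^ s) ⟩
  x * (j ^ s * suc n ^ s)  ≡⟨ cong (x *_) (^-distribʳ-* j (suc n) s) ⟨
  x * (j * suc n) ^ s      ≤⟨ *-monoʳ-≤ x (^-monoˡ-≤ s cross) ⟩
  x * (n * suc j) ^ s      ≡⟨ cong (x *_) (^-distribʳ-* n (suc j) s) ⟩
  x * (n ^ s * suc j ^ s)  ≡⟨ *-assoc x (n ^ s) (suc j ^ s) ⟨
  x * n ^ s * suc j ^ s    ≤⟨ *-monoˡ-≤ (suc j ^ s) x*nˢ≤jˢ*y ⟩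
  j ^ s * y * suc j ^ s    ≡⟨ x∙yz≈xz∙y (j ^ s) (suc j ^ s) y ⟨
  j ^ s * (suc j ^ s * y)  ∎)
  where
  open ≤-Reasoning
  cross : j * suc n ≤ n * suc j
  cross = begin
    j * suc n  ≡⟨ *-suc j n ⟩
    j + j * n  ≤⟨ +-monoˡ-≤ (j * n) j≤n ⟩
    n + j * n  ≡⟨ cong (n +_) (*-comm j n) ⟩
    n + n * j  ≡⟨ *-suc n j ⟨
    n * suc j  ∎

completions-bound : ∀ n k s → k ≤ n → completions n k s * n ^ s ≤ k ^ s * (n C k)
completions-bound n       k       zero    _         = ≤-reflexive (trans (*-identityʳ _) (sym (*-identityˡ _)))
completions-bound zero    k       (suc s) _         = z≤n
completions-bound (suc n) zero    (suc s) _         = z≤n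
completions-bound (suc n) (suc k) (suc s) (s≤s k≤n) = begin
  completions n k s * (suc n * suc n ^ s)    ≡⟨ x∙yz≈y∙xz (completions n k s) (suc n) (suc n ^ s) ⟩
  suc n * (completions n k s * suc n ^ s)    ≤⟨ *-monoʳ-≤ (suc n) (bound-suc n k s k≤n) ⟩
  suc n * (suc k ^ s * (n C k))              ≡⟨ x∙yz≈y∙xz (suc n) (suc k ^ s) (n C k) ⟩
  suc k ^ s * (suc n * (n C k))              ≡⟨ cong (suc k ^ s *_) ([1+k]*[1+n]C[1+k]≡[1+n]*nCk n k) ⟨
  suc k ^ s * (suc k * (suc n C suc k))      ≡⟨ x∙yz≈yx∙z (suc k ^ s) (suc k) (suc n C suc k) ⟩
  suc k * suc k ^ s * (suc n C suc k)        ∎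
  where
  open ≤-Reasoning
  bound-suc : ∀ m j t → j ≤ m → completions m j t * suc m ^ t ≤ suc j ^ t * (m C j)
  bound-suc m       (suc j) t       j<m =
    ratio-bound-suc (completions m (suc j) t) (m C suc j) t j<m (completions-bound m (suc j) t j<m)
  bound-suc m       zero    zero    _   = ≤-reflexive (trans (*-identityʳ _) (sym (+-identityʳ _)))
  bound-suc zero    zero    (suc t) _   = z≤n
  bound-suc (suc m) zero    (suc t) _   = z≤n

length-filter-map-≤ : ∀ {a b p q} {A : Set a} {B : Set b} {P : Pred B p} {Q : Pred A q}
                      (P? : Decidable P) (Q? : Decidable Q) (f : A → B) →
                      (∀ x → P (f x) → Q x) → ∀ xs → length (filter P? (map f xs)) ≤ length (filter Q? xs)
length-filter-map-≤ P? Q? f P∘f⇒Q []       = z≤n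
length-filter-map-≤ P? Q? f P∘f⇒Q (x ∷ xs) with P? (f x) | Q? x
... | yes _   | yes _  = s≤s (length-filter-map-≤ P? Q? f P∘f⇒Q xs)
... | yes pfx | no ¬qx = contradiction (P∘f⇒Q x pfx) ¬qx
... | no _    | yes _  = m≤n⇒m≤1+n (length-filter-map-≤ P? Q? f P∘f⇒Q xs)
... | no _    | no _   = length-filter-map-≤ P? Q? f P∘f⇒Q xs

Disjoint : Subset n → Subset n → Set
Disjoint F G = ∀ x → x ∈ F → x ∉ G

Transversalᴸ : ℕ → List (Subset n) → Subset n → Set
Transversalᴸ k Fs A = (∣ A ∣ ≡ k) × All (λ G → Nonempty (A ∩ G)) Fs

transversalᴸ? : (k : ℕ) (Fs : List (Subset n)) (A : Subset n) → Dec (Transversalᴸ k Fs A)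
transversalᴸ? k Fs A = (∣ A ∣ ≟ k) ×-dec all? (λ G → nonempty? (A ∩ G)) Fs

#Transversals : ℕ → List (Subset n) → List (Subset n) → ℕ
#Transversals k Fs As = length (filter (transversalᴸ? k Fs) As)

sizeProduct : List (Subset n) → ℕ
sizeProduct Fs = product (map ∣_∣ Fs)

avoids0? : Decidable {A = Subset (suc n)} (zero ∉_)
avoids0? G = ¬? (zero ∈? G)

tailsAvoiding0 : List (Subset (suc n)) → List (Subset n)
tailsAvoiding0 Fs = map tail (filter avoids0? Fs)

Nonempty-outside∩⇒tail : ∀ {A : Subset n} {G} → Nonempty ((outside ∷ A) ∩ G) → Nonempty (A ∩ tail G)
Nonempty-outside∩⇒tail {G = _ ∷ _} (suc x , there x∈) = x , x∈

Nonempty-inside∩⇒tail : ∀ {A : Subset n} {G} → zero ∉ G → Nonempty ((inside ∷ A) ∩ G) → Nonempty (A ∩ tail G)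
Nonempty-inside∩⇒tail {G = inside  ∷ _} 0∉G _                  = contradiction here 0∉G
Nonempty-inside∩⇒tail {G = outside ∷ _} _   (suc x , there x∈) = x , x∈

Disjoint-tail : ∀ {F G : Subset (suc n)} → Disjoint F G → Disjoint (tail F) (tail G)
Disjoint-tail {F = _ ∷ _} {G = _ ∷ _} F∩G≡∅ x x∈F x∈G = F∩G≡∅ (suc x) (there x∈F) (there x∈G)

tails-pairwiseDisjoint : {Fs : List (Subset (suc n))} → AllPairs Disjoint Fs → AllPairs Disjoint (map tail Fs)
tails-pairwiseDisjoint = AllPairsₚ.map⁺ ∘ AllPairs.map Disjoint-tail

tailsAvoiding0-pairwiseDisjoint : {Fs : List (Subset (suc n))} → AllPairs Disjoint Fs → AllPairs Disjoint (tailsAvoiding0 Fs)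
tailsAvoiding0-pairwiseDisjoint = tails-pairwiseDisjoint ∘ AllPairsₚ.filter⁺ avoids0?

sizeProduct-tails-≤ : ∀ (Fs : List (Subset (suc n))) → sizeProduct (map tail Fs) ≤ sizeProduct Fs
sizeProduct-tails-≤ []                  = ≤-refl
sizeProduct-tails-≤ ((outside ∷ F) ∷ Fs) = *-monoʳ-≤ ∣ F ∣ (sizeProduct-tails-≤ Fs)
sizeProduct-tails-≤ ((inside  ∷ F) ∷ Fs) = *-mono-≤ (n≤1+n ∣ F ∣) (sizeProduct-tails-≤ Fs)

sizeProduct-tails-avoiding0 : ∀ {Fs : List (Subset (suc n))} → All (zero ∉_) Fs → sizeProduct (map tail Fs) ≡ sizeProduct Fs
sizeProduct-tails-avoiding0 {Fs = []}                  []          = refl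
sizeProduct-tails-avoiding0 {Fs = (outside ∷ F) ∷ Fs} (_ ∷ 0∉Fs)  = cong (∣ F ∣ *_) (sizeProduct-tails-avoiding0 0∉Fs)
sizeProduct-tails-avoiding0 {Fs = (inside  ∷ F) ∷ Fs} (0∉F ∷ _)   = contradiction here 0∉F

tailsAvoiding0-avoiding0 : ∀ {Fs : List (Subset (suc n))} → All (zero ∉_) Fs → tailsAvoiding0 Fs ≡ map tail Fs
tailsAvoiding0-avoiding0 0∉Fs = cong (map tail) (filter-all avoids0? 0∉Fs)

-- By disjointness, at most one member of the family contains 0; if F does, |F| = 1 + |tail F|
-- splits the product of sizes accordingly.
data ZeroCover (Fs : List (Subset (suc n))) : Set where
  uncovered   : All (zero ∉_) Fs → ZeroCover Fs
  coveredOnce : sizeProduct Fs ≡ sizeProduct (tailsAvoiding0 Fs) + sizeProduct (map tail Fs) →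
                length Fs ≡ suc (length (tailsAvoiding0 Fs)) → ZeroCover Fs

zeroCover : ∀ (Fs : List (Subset (suc n))) → AllPairs Disjoint Fs → ZeroCover Fs
zeroCover []                   []             = uncovered []
zeroCover ((outside ∷ F) ∷ Fs) (_ ∷ disjoint) with zeroCover Fs disjoint
... | uncovered 0∉Fs = uncovered ((λ ()) ∷ 0∉Fs)
... | coveredOnce product≡ length≡ =
  coveredOnce (trans (cong (∣ F ∣ *_) product≡) (*-distribˡ-+ ∣ F ∣ _ _)) (cong suc length≡)
zeroCover ((inside ∷ F) ∷ Fs)  (F∩Fs≡∅ ∷ _) = coveredOnce
  (cong₂ (λ p q → p + ∣ F ∣ * q) (sym (trans (cong sizeProduct avoid≡tails) tails≡)) (sym tails≡))
  (cong suc (sym (trans (cong length avoid≡tails) (length-map tail Fs))))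
  where
  0∉Fs : All (zero ∉_) Fs
  0∉Fs = All.map (λ F∩G≡∅ → F∩G≡∅ zero here) F∩Fs≡∅
  avoid≡tails : tailsAvoiding0 Fs ≡ map tail Fs
  avoid≡tails = tailsAvoiding0-avoiding0 0∉Fs
  tails≡ : sizeProduct (map tail Fs) ≡ sizeProduct Fs
  tails≡ = sizeProduct-tails-avoiding0 0∉Fs

#Transversals-++ : ∀ k (Fs : List (Subset n)) As Bs →
                   #Transversals k Fs (As ++ Bs) ≡ #Transversals k Fs As + #Transversals k Fs Bs
#Transversals-++ k Fs As Bs =
  trans (cong length (filter-++ (transversalᴸ? k Fs) As Bs)) (length-++ (filter (transversalᴸ? k Fs) As))

#Transversals-inside-zero : ∀ (Fs : List (Subset (suc n))) As → #Transversals 0 Fs (map (inside ∷_) As) ≡ 0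
#Transversals-inside-zero Fs As =
  cong length (filter-none (transversalᴸ? 0 Fs) (Allₚ.map⁺ (All.universal (λ { _ (() , _) }) As)))

TransversalBound : ℕ → Set
TransversalBound n = ∀ k (Fs : List (Subset n)) → AllPairs Disjoint Fs →
                     #Transversals k Fs (allSubsets n) ≤ sizeProduct Fs * completions n k (length Fs)

#Transversals-outside-bound : TransversalBound n → ∀ k (Fs : List (Subset (suc n))) → AllPairs Disjoint Fs →
                              #Transversals k Fs (map (outside ∷_) (allSubsets n))
                                ≤ sizeProduct (map tail Fs) * completions n k (length Fs)
#Transversals-outside-bound {n} bound k Fs disjoint = begin
  #Transversals k Fs (map (outside ∷_) (allSubsets n))
    ≤⟨ length-filter-map-≤ (transversalᴸ? k Fs) (transversalᴸ? k (map tail Fs)) (outside ∷_) restrict (allSubsets n) ⟩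
  #Transversals k (map tail Fs) (allSubsets n)
    ≤⟨ bound k (map tail Fs) (tails-pairwiseDisjoint disjoint) ⟩
  sizeProduct (map tail Fs) * completions n k (length (map tail Fs))
    ≡⟨ cong (λ t → sizeProduct (map tail Fs) * completions n k t) (length-map tail Fs) ⟩
  sizeProduct (map tail Fs) * completions n k (length Fs) ∎
  where
  open ≤-Reasoning
  restrict : ∀ A → Transversalᴸ k Fs (outside ∷ A) → Transversalᴸ k (map tail Fs) A
  restrict A (∣A∣≡k , meets) = ∣A∣≡k , Allₚ.map⁺ (All.map Nonempty-outside∩⇒tail meets)

#Transversals-inside-bound : TransversalBound n → ∀ k (Fs : List (Subset (suc n))) → AllPairs Disjoint Fs →
                             #Transversals (suc k) Fs (map (inside ∷_) (allSubsets n))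
                               ≤ sizeProduct (tailsAvoiding0 Fs) * completions n k (length (tailsAvoiding0 Fs))
#Transversals-inside-bound {n} bound k Fs disjoint = begin
  #Transversals (suc k) Fs (map (inside ∷_) (allSubsets n))
    ≤⟨ length-filter-map-≤ (transversalᴸ? (suc k) Fs) (transversalᴸ? k (tailsAvoiding0 Fs)) (inside ∷_)
                           restrict (allSubsets n) ⟩
  #Transversals k (tailsAvoiding0 Fs) (allSubsets n)
    ≤⟨ bound k (tailsAvoiding0 Fs) (tailsAvoiding0-pairwiseDisjoint disjoint) ⟩
  sizeProduct (tailsAvoiding0 Fs) * completions n k (length (tailsAvoiding0 Fs)) ∎
  where
  open ≤-Reasoning
  restrict : ∀ A → Transversalᴸ (suc k) Fs (inside ∷ A) → Transversalᴸ k (tailsAvoiding0 Fs) A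
  restrict A (∣A∣≡1+k , meets) = suc-injective ∣A∣≡1+k
    , Allₚ.map⁺ (All.zipWith (λ (0∉G , ne) → Nonempty-inside∩⇒tail 0∉G ne)
                             (Allₚ.all-filter avoids0? Fs , Allₚ.filter⁺ avoids0? meets))

#Transversals-inside-bound-avoiding0 : TransversalBound n → ∀ k {Fs : List (Subset (suc n))} →
                                       AllPairs Disjoint Fs → All (zero ∉_) Fs →
                                       #Transversals (suc k) Fs (map (inside ∷_) (allSubsets n))
                                         ≤ sizeProduct Fs * completions n k (length Fs)
#Transversals-inside-bound-avoiding0 {n} bound k {Fs} disjoint 0∉Fs = begin
  #Transversals (suc k) Fs (map (inside ∷_) (allSubsets n))
    ≤⟨ #Transversals-inside-bound bound k Fs disjoint ⟩
  sizeProduct (tailsAvoiding0 Fs) * completions n k (length (tailsAvoiding0 Fs))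
    ≡⟨ cong (λ Gs → sizeProduct Gs * completions n k (length Gs)) (tailsAvoiding0-avoiding0 0∉Fs) ⟩
  sizeProduct (map tail Fs) * completions n k (length (map tail Fs))
    ≡⟨ cong (λ t → sizeProduct (map tail Fs) * completions n k t) (length-map tail Fs) ⟩
  sizeProduct (map tail Fs) * completions n k (length Fs)
    ≤⟨ *-monoˡ-≤ (completions n k (length Fs)) (sizeProduct-tails-≤ Fs) ⟩
  sizeProduct Fs * completions n k (length Fs) ∎
  where open ≤-Reasoning

transversalBound-zero : TransversalBound 0
transversalBound-zero zero    []        _ = ≤-refl
transversalBound-zero (suc k) Fs        _ = z≤n
transversalBound-zero zero    ([] ∷ Fs) _ = z≤n

transversalBound-suc : TransversalBound n → TransversalBound (suc n)
transversalBound-suc {n} bound k Fs disjoint = begin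
  #Transversals k Fs (map (inside ∷_) As ++ map (outside ∷_) As)
    ≡⟨ #Transversals-++ k Fs (map (inside ∷_) As) (map (outside ∷_) As) ⟩
  #Transversals k Fs (map (inside ∷_) As) + #Transversals k Fs (map (outside ∷_) As)
    ≤⟨ split k (zeroCover Fs disjoint) ⟩
  P * completions (suc n) k s ∎
  where
  open ≤-Reasoning
  As = allSubsets n
  s  = length Fs
  P  = sizeProduct Fs
  P′ = sizeProduct (map tail Fs)
  P″ = sizeProduct (tailsAvoiding0 Fs)

  split : ∀ j → ZeroCover Fs →
          #Transversals j Fs (map (inside ∷_) As) + #Transversals j Fs (map (outside ∷_) As) ≤ P * completions (suc n) j s
  split zero _ = begin
    #Transversals 0 Fs (map (inside ∷_) As) + #Transversals 0 Fs (map (outside ∷_) As)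
      ≡⟨ cong (_+ #Transversals 0 Fs (map (outside ∷_) As)) (#Transversals-inside-zero Fs As) ⟩
    #Transversals 0 Fs (map (outside ∷_) As)  ≤⟨ #Transversals-outside-bound bound 0 Fs disjoint ⟩
    P′ * completions n 0 s                     ≤⟨ *-mono-≤ (sizeProduct-tails-≤ Fs) (completions-mono n 0 s) ⟩
    P * completions (suc n) 0 s                ∎
  split (suc j) (uncovered 0∉Fs) = begin
    #Transversals (suc j) Fs (map (inside ∷_) As) + #Transversals (suc j) Fs (map (outside ∷_) As)
      ≤⟨ +-mono-≤ (#Transversals-inside-bound-avoiding0 bound j disjoint 0∉Fs)
                  (≤-trans (#Transversals-outside-bound bound (suc j) Fs disjoint)
                           (*-monoˡ-≤ _ (sizeProduct-tails-≤ Fs))) ⟩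
    P * completions n j s + P * completions n (suc j) s  ≡⟨ *-distribˡ-+ P (completions n j s) (completions n (suc j) s) ⟨
    P * (completions n j s + completions n (suc j) s)    ≤⟨ *-monoʳ-≤ P (completions-pascal n j s) ⟩
    P * completions (suc n) (suc j) s                    ∎
  split (suc j) (coveredOnce P≡P″+P′ s≡1+s″) = begin
    #Transversals (suc j) Fs (map (inside ∷_) As) + #Transversals (suc j) Fs (map (outside ∷_) As)
      ≤⟨ +-mono-≤ (#Transversals-inside-bound bound j Fs disjoint)
                  (≤-trans (#Transversals-outside-bound bound (suc j) Fs disjoint)
                           (*-monoʳ-≤ P′ (completions-mono n (suc j) s))) ⟩
    P″ * completions (suc n) (suc j) (suc (length (tailsAvoiding0 Fs))) + P′ * completions (suc n) (suc j) s
      ≡⟨ cong (λ t → P″ * completions (suc n) (suc j) t + P′ * completions (suc n) (suc j) s) s≡1+s″ ⟨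
    P″ * completions (suc n) (suc j) s + P′ * completions (suc n) (suc j) s
      ≡⟨ *-distribʳ-+ (completions (suc n) (suc j) s) P″ P′ ⟨
    (P″ + P′) * completions (suc n) (suc j) s  ≡⟨ cong (_* completions (suc n) (suc j) s) P≡P″+P′ ⟨
    P * completions (suc n) (suc j) s          ∎

transversalBound : ∀ n → TransversalBound n
transversalBound zero    = transversalBound-zero
transversalBound (suc n) = transversalBound-suc (transversalBound n)

sizeProduct-≤ : ∀ k (Gs : List (Subset n)) → All (λ G → ∣ G ∣ ≤ k) Gs → sizeProduct Gs ≤ k ^ length Gs
sizeProduct-≤ k []       []              = ≤-refl
sizeProduct-≤ k (G ∷ Gs) (∣G∣≤k ∷ ∣Gs∣≤k) = *-mono-≤ ∣G∣≤k (sizeProduct-≤ k Gs ∣Gs∣≤k)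

countTransversals≡#Transversals : ∀ {s} n k (F : Fin s → Subset n) →
                                  countTransversals n k F ≡ #Transversals k (tabulate F) (allSubsets n)
countTransversals≡#Transversals n k F = cong length
  (filter-≐ (transversal? k F) (transversalᴸ? k (tabulate F)) (map₂ Allₚ.tabulate⁺ , map₂ Allₚ.tabulate⁻) (allSubsets n))

claim1 : (n k s : ℕ) → .{{NonZero n}} → .{{NonZero k}} → .{{NonZero s}} →
         k * k ≤ n →
         (F : Fin s → Subset n) →
         PairwiseDisjoint F →
         (∀ j → ∣ F j ∣ ≤ k) →
         countTransversals n k F * n ^ s ≤ (k * k) ^ s * (n C k)
claim1 n k s k*k≤n F disjoint ∣F∣≤k = begin
  countTransversals n k F * n ^ s                    ≡⟨ cong (_* n ^ s) (countTransversals≡#Transversals n k F) ⟩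
  #Transversals k Fs (allSubsets n) * n ^ s          ≤⟨ *-monoˡ-≤ (n ^ s) count-bound ⟩
  sizeProduct Fs * completions n k s * n ^ s         ≡⟨ *-assoc (sizeProduct Fs) (completions n k s) (n ^ s) ⟩
  sizeProduct Fs * (completions n k s * n ^ s)       ≤⟨ *-mono-≤ sizes-bound (completions-bound n k s k≤n) ⟩
  k ^ s * (k ^ s * (n C k))                          ≡⟨ *-assoc (k ^ s) (k ^ s) (n C k) ⟨
  k ^ s * k ^ s * (n C k)                            ≡⟨ cong (_* (n C k)) (^-distribʳ-* k k s) ⟨
  (k * k) ^ s * (n C k)                              ∎
  where
  open ≤-Reasoning
  Fs = tabulate F
  k≤n : k ≤ n
  k≤n = ≤-trans (m≤m*n k k) k*k≤n
  count-bound : #Transversals k Fs (allSubsets n) ≤ sizeProduct Fs * completions n k s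
  count-bound = subst (λ t → #Transversals k Fs (allSubsets n) ≤ sizeProduct Fs * completions n k t) (length-tabulate F)
                      (transversalBound n k Fs (AllPairsₚ.tabulate⁺ (λ {i} {j} → disjoint i j)))
  sizes-bound : sizeProduct Fs ≤ k ^ s
  sizes-bound = subst (λ t → sizeProduct Fs ≤ k ^ t) (length-tabulate F) (sizeProduct-≤ k Fs (Allₚ.tabulate⁺ ∣F∣≤k))
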